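{- A finite triangle-free simple graph $G$ admits a two-acyclic factorization system if and only if its chromatic number satisfies $\chi(G)\le 3$.
   Context: All directed (multi)graphs are considered with a loop at every vertex. For a directed multigraph $(G,\to)$, an arrow $x\to y$ is called an $\hookrightarrow$-arrow ($x\hookrightarrow y$) if for every $z$ with $z\to x$ there is an arrow $z\to y$, and an $\twoheadrightarrow$-arrow ($x\twoheadrightarrow y$) if for every $z$ with $y\to z$ there is an arrow $x\to z$ (an arrow may be both). $(G,\to)$ forms a two-acyclic factorization system if: (i) there are no $x\twoheadrightarrow y\twoheadrightarrow x$ and no $x\hookrightarrow y\hookrightarrow x$ with $x\ne y$; (ii) there is no $x\twoheadrightarrow y\hookrightarrow x$ with $x\neq y$; (iii) for each arrow $x\to z$ there is $y$ with $x\twoheadrightarrow y\hookrightarrow z$. An undirected graph admits a two-acyclic factorization system if some orientation of its edges (together with the loops) forms one. -}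

module Defs where

open import Data.Nat using (ℕ)
open import Data.Fin using (Fin)
open import Data.Bool using (Bool; true; false)
open import Data.Product using (Σ; ∃; _×_)
open import Data.Sum using (_⊎_)
open import Data.Empty using (⊥)
open import Relation.Nullary using (¬_)
open import Relation.Binary.PropositionalEquality using (_≡_; _≢_)

record SimpleGraph (n : ℕ) : Set where
  field
    adj    : Fin n → Fin n → Bool
    sym    : ∀ x y → adj x y ≡ adj y x
    irrefl : ∀ x → adj x x ≡ false

module _ {n : ℕ} (G : SimpleGraph n) where
  open SimpleGraph G

  Edge : Fin n → Fin n → Set
  Edge x y = adj x y ≡ true

  TriangleFree : Set
  TriangleFree = ∀ x y z → ¬ (Edge x y × Edge y z × Edge x z)

  ProperColouring : ℕ → Set
  ProperColouring k = Σ (Fin n → Fin k) λ c → ∀ x y → Edge x y → c x ≢ c y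

  ChromaticNumber≤ : ℕ → Set
  ChromaticNumber≤ k = ProperColouring k

  record Orientation : Set₁ where
    field
      dir       : Fin n → Fin n → Set
      dir⇒edge  : ∀ x y → dir x y → Edge x y
      edge⇒dir  : ∀ x y → Edge x y → dir x y ⊎ dir y x
      antisym   : ∀ x y → dir x y → dir y x → ⊥

-- Directed graphs (with a loop at every vertex) on Fin n, given by the arrow relation.
module FactSys {n : ℕ} (_⟶_ : Fin n → Fin n → Set) where

  _↪_ : Fin n → Fin n → Set
  x ↪ y = (x ⟶ y) × (∀ z → z ⟶ x → z ⟶ y)

  _↠_ : Fin n → Fin n → Set
  x ↠ y = (x ⟶ y) × (∀ z → y ⟶ z → x ⟶ z)

  record IsTwoAcyclicFactorizationSystem : Set where
    field
      ↠-acyclic : ∀ x y → x ↠ y → y ↠ x → x ≡ y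
      ↪-acyclic : ∀ x y → x ↪ y → y ↪ x → x ≡ y
      no-↠↪     : ∀ x y → x ↠ y → y ↪ x → x ≡ y
      factor    : ∀ x z → x ⟶ z → ∃ λ y → (x ↠ y) × (y ↪ z)

module _ {n : ℕ} (G : SimpleGraph n) where
  arrowOf : Orientation G → Fin n → Fin n → Set
  arrowOf O x y = (x ≡ y) ⊎ Orientation.dir O x y

  AdmitsTwoAcyclicFS : Set₁
  AdmitsTwoAcyclicFS =
    Σ (Orientation G) λ O → FactSys.IsTwoAcyclicFactorizationSystem (arrowOf O)

{-# OPTIONS --safe #-}
-- Both directions pass through orientations without a directed walk of
-- length 3. Such an orientation is a two-acyclic factorization system, since
-- each arrow starts at a source, hence is a ↪-arrow, or ends at a sink, hence
-- is a ↠-arrow; and it is 3-coloured by sources / inner vertices / sinks.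
-- Conversely, if w → x → y → u in a triangle-free factorization system,
-- factoring x → y as x ↠ m ↪ y yields an arrow w → y (m = x), x → u (m = y)
-- or a path x → m → y, each of which closes a triangle. Finally, orienting a
-- proper 3-colouring towards the larger colour leaves no walk of length 3.
module Submission where

open import Defs
open import Level using (0ℓ; _⊔_)
open import Data.Nat using (ℕ; _≤_; s≤s; z≤n)
open import Data.Nat.Properties using (≤-trans; <⇒≱)
open import Data.Fin using (Fin; zero; suc; toℕ; _<_)
open import Data.Fin.Properties using (any?; <-cmp; <-asym; toℕ<n)
open import Data.Bool using (true)
open import Data.Bool.Properties using (_≟_)
open import Data.Product using (_×_; _,_; proj₁; ∃)
open import Data.Sum using (_⊎_; inj₁; inj₂)
open import Data.Empty using (⊥; ⊥-elim)
open import Function using (_∘_)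
open import Relation.Nullary using (¬_; yes; no)
open import Relation.Binary using (Rel; Reflexive; Antisymmetric; Decidable; tri<; tri≈; tri>)
open import Relation.Binary.PropositionalEquality using (_≡_; _≢_; refl; sym; subst)

Walk₃-free : ∀ {a ℓ} {A : Set a} → Rel A ℓ → Set (a ⊔ ℓ)
Walk₃-free R = ∀ {w x y u} → R w x → R x y → R y u → ⊥

module Positions {n ℓ} {R : Rel (Fin n) ℓ} (R? : Decidable R) where

  data Position (x : Fin n) : Set ℓ where
    source : ¬ ∃ (λ w → R w x) → Position x
    inner  : ∃ (λ w → R w x) → ∃ (λ u → R x u) → Position x
    sink   : ∃ (λ w → R w x) → ¬ ∃ (λ u → R x u) → Position x

  position : ∀ x → Position x
  position x with any? (λ w → R? w x) | any? (R? x)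
  ... | no ∄w  | _      = source ∄w
  ... | yes ∃w | yes ∃u = inner ∃w ∃u
  ... | yes ∃w | no ∄u  = sink ∃w ∄u

  positionColour : ∀ {x} → Position x → Fin 3
  positionColour (source _)  = zero
  positionColour (inner _ _) = suc zero
  positionColour (sink _ _)  = suc (suc zero)

  positionColour-≢ : Walk₃-free R → ∀ {x y} → R x y →
                     (p : Position x) (q : Position y) → positionColour p ≢ positionColour q
  positionColour-≢ _    {x}     xRy (source _)          (source ∄w)         _ = ∄w (x , xRy)
  positionColour-≢ free         xRy (inner (_ , wRx) _) (inner _ (_ , yRu)) _ = free wRx xRy yRu
  positionColour-≢ _    {_} {y} xRy (sink _ ∄u)         (sink _ _)          _ = ∄u (y , xRy)
  positionColour-≢ _ _ (source _)  (inner _ _) ()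
  positionColour-≢ _ _ (source _)  (sink _ _)  ()
  positionColour-≢ _ _ (inner _ _) (source _)  ()
  positionColour-≢ _ _ (inner _ _) (sink _ _)  ()
  positionColour-≢ _ _ (sink _ _)  (source _)  ()
  positionColour-≢ _ _ (sink _ _)  (inner _ _) ()

  colourByPosition : Fin n → Fin 3
  colourByPosition x = positionColour (position x)

  colourByPosition-≢ : Walk₃-free R → ∀ {x y} → R x y → colourByPosition x ≢ colourByPosition y
  colourByPosition-≢ free {x} {y} xRy = positionColour-≢ free xRy (position x) (position y)

module _ {n : ℕ} (_⟶_ : Rel (Fin n) 0ℓ) where
  open FactSys _⟶_

  ↪-refl : Reflexive _⟶_ → ∀ {x} → x ↪ x
  ↪-refl refl⟶ = refl⟶ , λ _ z⟶x → z⟶x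

  ↠-refl : Reflexive _⟶_ → ∀ {x} → x ↠ x
  ↠-refl refl⟶ = refl⟶ , λ _ x⟶z → x⟶z

  isTwoAcyclicFS-if-↪⊎↠ : Reflexive _⟶_ → Antisymmetric _≡_ _⟶_ →
                           (∀ {x z} → x ⟶ z → x ↪ z ⊎ x ↠ z) → IsTwoAcyclicFactorizationSystem
  isTwoAcyclicFS-if-↪⊎↠ refl⟶ antisym⟶ ↪⊎↠ = record
    { ↠-acyclic = λ _ _ x↠y y↠x → antisym⟶ (proj₁ x↠y) (proj₁ y↠x)
    ; ↪-acyclic = λ _ _ x↪y y↪x → antisym⟶ (proj₁ x↪y) (proj₁ y↪x)
    ; no-↠↪     = λ _ _ x↠y y↪x → antisym⟶ (proj₁ x↠y) (proj₁ y↪x)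
    ; factor    = factor
    }
    where
    factor : ∀ x z → x ⟶ z → ∃ λ y → (x ↠ y) × (y ↪ z)
    factor x z x⟶z with ↪⊎↠ x⟶z
    ... | inj₁ x↪z = x , ↠-refl refl⟶ , x↪z
    ... | inj₂ x↠z = z , x↠z , ↪-refl refl⟶

module _ {n : ℕ} (G : SimpleGraph n) (O : Orientation G) where
  open Orientation O
  open FactSys (arrowOf G O)

  dir? : Decidable dir
  dir? x y with SimpleGraph.adj G x y ≟ true
  ... | no ¬edge = no (¬edge ∘ dir⇒edge x y)
  ... | yes edge with edge⇒dir x y edge
  ...   | inj₁ x→y = yes x→y
  ...   | inj₂ y→x = no λ x→y → antisym x y x→y y→x

  walk₃-free-colouring : Walk₃-free dir → ChromaticNumber≤ G 3
  walk₃-free-colouring free = colourByPosition , proper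
    where
    open Positions dir?
    proper : ∀ x y → Edge G x y → colourByPosition x ≢ colourByPosition y
    proper x y edge with edge⇒dir x y edge
    ... | inj₁ x→y = colourByPosition-≢ free x→y
    ... | inj₂ y→x = colourByPosition-≢ free y→x ∘ sym

  arrowOf-antisym : Antisymmetric _≡_ (arrowOf G O)
  arrowOf-antisym (inj₁ x≡y) _           = x≡y
  arrowOf-antisym (inj₂ _)   (inj₁ y≡x)  = sym y≡x
  arrowOf-antisym (inj₂ x→y) (inj₂ y→x)  = ⊥-elim (antisym _ _ x→y y→x)

  ↪-from-source : ∀ {x z} → (∀ w → ¬ dir w x) → arrowOf G O x z → x ↪ z
  ↪-from-source source x⟶z = x⟶z , λ { _ (inj₁ refl) → x⟶z ; w (inj₂ w→x) → ⊥-elim (source w w→x) }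

  ↠-into-sink : ∀ {x z} → (∀ u → ¬ dir z u) → arrowOf G O x z → x ↠ z
  ↠-into-sink sink x⟶z = x⟶z , λ { _ (inj₁ refl) → x⟶z ; u (inj₂ z→u) → ⊥-elim (sink u z→u) }

  walk₃-free⇒isTwoAcyclicFS : Walk₃-free dir → IsTwoAcyclicFactorizationSystem
  walk₃-free⇒isTwoAcyclicFS free =
    isTwoAcyclicFS-if-↪⊎↠ (arrowOf G O) (inj₁ refl) arrowOf-antisym ↪⊎↠
    where
    ↪⊎↠ : ∀ {x z} → arrowOf G O x z → x ↪ z ⊎ x ↠ z
    ↪⊎↠ (inj₁ refl) = inj₁ (↪-refl (arrowOf G O) (inj₁ refl))
    ↪⊎↠ {x} (inj₂ x→z) with any? (λ w → dir? w x)
    ... | no ∄w          = inj₁ (↪-from-source (λ w w→x → ∄w (w , w→x)) (inj₂ x→z))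
    ... | yes (_ , w→x) = inj₂ (↠-into-sink (λ _ z→u → free w→x x→z z→u) (inj₂ x→z))

  module _ (triangle-free : TriangleFree G) where

    no-shortcut : ∀ {x y z} → dir x y → dir y z → ¬ arrowOf G O x z
    no-shortcut x→y y→z (inj₁ refl) = antisym _ _ x→y y→z
    no-shortcut x→y y→z (inj₂ x→z) =
      triangle-free _ _ _ (dir⇒edge _ _ x→y , dir⇒edge _ _ y→z , dir⇒edge _ _ x→z)

    factorization⇒walk₃-free : (∀ x z → arrowOf G O x z → ∃ λ y → (x ↠ y) × (y ↪ z)) →
                               Walk₃-free dir
    factorization⇒walk₃-free factor {w} {x} {y} {u} w→x x→y y→u with factor x y (inj₂ x→y)
    ... | _ , (inj₁ refl , _)  , (_ , m↪y)        = no-shortcut w→x x→y (m↪y w (inj₂ w→x))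
    ... | _ , (inj₂ _ , x↠m)   , (inj₁ refl , _)  = no-shortcut x→y y→u (x↠m u (inj₂ y→u))
    ... | _ , (inj₂ x→m , _)   , (inj₂ m→y , _)   = no-shortcut x→m m→y (inj₂ x→y)

Fin3-no-<-chain₃ : ∀ {i j k l : Fin 3} → i < j → j < k → k < l → ⊥
Fin3-no-<-chain₃ {l = l} i<j j<k k<l = <⇒≱ (toℕ<n l) 3≤l
  where
  3≤l : 3 ≤ toℕ l
  3≤l = ≤-trans (s≤s (≤-trans (s≤s (≤-trans (s≤s z≤n) i<j)) j<k)) k<l

module _ {n : ℕ} (G : SimpleGraph n) (c : Fin n → Fin 3) (proper : ∀ x y → Edge G x y → c x ≢ c y) where

  ascending : Orientation G
  ascending = record
    { dir      = λ x y → Edge G x y × c x < c y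
    ; dir⇒edge = λ _ _ → proj₁
    ; edge⇒dir = edge⇒dir
    ; antisym  = λ _ _ (_ , cx<cy) (_ , cy<cx) → <-asym cx<cy cy<cx
    }
    where
    edge⇒dir : ∀ x y → Edge G x y → (Edge G x y × c x < c y) ⊎ (Edge G y x × c y < c x)
    edge⇒dir x y edge with <-cmp (c x) (c y)
    ... | tri< cx<cy _ _ = inj₁ (edge , cx<cy)
    ... | tri≈ _ cx≡cy _ = ⊥-elim (proper x y edge cx≡cy)
    ... | tri> _ _ cy<cx = inj₂ (subst (_≡ true) (SimpleGraph.sym G x y) edge , cy<cx)

  ascending-walk₃-free : Walk₃-free (Orientation.dir ascending)
  ascending-walk₃-free (_ , cw<cx) (_ , cx<cy) (_ , cy<cu) = Fin3-no-<-chain₃ cw<cx cx<cy cy<cu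

proposition3p41 : (n : ℕ) (G : SimpleGraph n) → TriangleFree G →
    (AdmitsTwoAcyclicFS G → ChromaticNumber≤ G 3) × (ChromaticNumber≤ G 3 → AdmitsTwoAcyclicFS G)
proposition3p41 _ G triangle-free = ⇒ , ⇐
  where
  ⇒ : AdmitsTwoAcyclicFS G → ChromaticNumber≤ G 3
  ⇒ (O , fs) = walk₃-free-colouring G O (factorization⇒walk₃-free G O triangle-free
                 (FactSys.IsTwoAcyclicFactorizationSystem.factor fs))

  ⇐ : ChromaticNumber≤ G 3 → AdmitsTwoAcyclicFS G
  ⇐ (c , proper) = ascending G c proper , walk₃-free⇒isTwoAcyclicFS G (ascending G c proper)
                     (ascending-walk₃-free G c proper)
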